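{- Let $(\Sigma,\Gamma,\mathcal U)$ be a (pure) many-sorted finite model finding problem and let $f:A_1\times\dots\times A_k\to B$ be a domain-range distinct function symbol of $\Sigma$. Take an arbitrary ordering $t_1,\dots,t_m$ of the tuples in $\mathcal U(A_1)\times\dots\times\mathcal U(A_k)$ and enumerate $\mathcal U(B)$ as $b_1,\dots,b_n$ (without repetition). Let $I$ be any interpretation of $(\Sigma,\Gamma,\mathcal U)$. Then there exists an interpretation $I'$ isomorphic to $I$ satisfying the strong ordered range constraints $\bigvee_{j=1}^{i} f(t_i)=b_j$ for each $i=1,\dots,\min\{m,n\}$, i.e. $I'(f)(t_i)\in\{b_1,\dots,b_i\}$ for these $i$.
   Context: A function symbol $f:A_1\times\dots\times A_k\to B$ is domain-range distinct (DRD) if its result sort $B$ is distinct from each of its argument sorts $A_1,\dots,A_k$ (the $A_i$ need not be distinct from each other). A signature $\Sigma$ consists of a finite set of sorts, a finite set of function symbols $g:A_1\times\dots\times A_n\to B$ (constants when $n=0$), and a finite set of predicate symbols $R:A_1\times\dots\times A_n\to\mathrm{Bool}$. A domain assignment $\mathcal U$ maps each sort to a nonempty finite set. A (pure) MSFMF problem is $(\Sigma,\Gamma,\mathcal U)$ with $\Gamma$ a finite set of many-sorted first-order formulas (with equality) over $\Sigma$ not mentioning domain elements. An interpretation $I$ assigns each function symbol $g:A_1\times\dots\times A_n\to B$ a function $\mathcal U(A_1)\times\dots\times\mathcal U(A_n)\to\mathcal U(B)$ and each predicate symbol a relation on the corresponding product of domains. A domain permutation $\sigma$ is a family of permutations $\sigma_\theta$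 of $\mathcal U(\theta)$, one per sort; it acts by $(\sigma\bullet I)(g)(\sigma_{A_1}(a_1),\dots,\sigma_{A_n}(a_n))=\sigma_B(I(g)(a_1,\dots,a_n))$ and $(a_1,\dots,a_n)\in I(R)\iff(\sigma_{A_1}(a_1),\dots,\sigma_{A_n}(a_n))\in(\sigma\bullet I)(R)$. Interpretations $I,I'$ are isomorphic if $I'=\sigma\bullet I$ for some domain permutation $\sigma$. -}

module Defs where

open import Data.Nat using (ℕ; _<_)
open import Data.Fin using (Fin)
open import Data.Bool using (Bool)
open import Data.List using (List)
open import Data.List.Relation.Unary.All as All using (All)
open import Data.Product using (Σ; ∃; _×_)
open import Data.Fin.Permutation using (Permutation′; _⟨$⟩ʳ_)
open import Relation.Binary.PropositionalEquality using (_≡_; _≢_)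

record Signature : Set where
  field
    nSorts  : ℕ
    nFuns   : ℕ
    nPreds  : ℕ
    funArgs  : Fin nFuns → List (Fin nSorts)
    funRes   : Fin nFuns → Fin nSorts
    predArgs : Fin nPreds → List (Fin nSorts)

open Signature public

DRD : (Σ' : Signature) → Fin (nFuns Σ') → Set
DRD Σ' f = All (λ A → A ≢ funRes Σ' f) (funArgs Σ' f)

-- A domain assignment maps each sort to a nonempty finite set, represented
-- (up to renaming) by Fin (size θ) with 0 < size θ.
record DomainAssignment (Σ' : Signature) : Set where
  field
    size     : Fin (nSorts Σ') → ℕ
    nonempty : ∀ θ → 0 < size θ

open DomainAssignment public

module _ {Σ' : Signature} (U : DomainAssignment Σ') where

  Dom : Fin (nSorts Σ') → Set
  Dom θ = Fin (size U θ)

  Tuple : List (Fin (nSorts Σ')) → Set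
  Tuple as = All Dom as

  record Interpretation : Set where
    field
      fun  : (g : Fin (nFuns Σ')) → Tuple (funArgs Σ' g) → Dom (funRes Σ' g)
      pred : (R : Fin (nPreds Σ')) → Tuple (predArgs Σ' R) → Bool

  open Interpretation public

  DomainPermutation : Set
  DomainPermutation = (θ : Fin (nSorts Σ')) → Permutation′ (size U θ)

  permTuple : DomainPermutation → ∀ {as} → Tuple as → Tuple as
  permTuple σ = All.map (λ {θ} a → σ θ ⟨$⟩ʳ a)

  IsAction : DomainPermutation → Interpretation → Interpretation → Set
  IsAction σ I I' =
    ((g : Fin (nFuns Σ')) (t : Tuple (funArgs Σ' g)) →
       fun I' g (permTuple σ t) ≡ σ (funRes Σ' g) ⟨$⟩ʳ fun I g t)
    × ((R : Fin (nPreds Σ')) (t : Tuple (predArgs Σ' R)) →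
       pred I' R (permTuple σ t) ≡ pred I R t)

  Isomorphic : Interpretation → Interpretation → Set
  Isomorphic I I' = ∃ λ σ → IsAction σ I I'

-- Only the sort B of f needs relabelling, and since f is domain-range distinct this
-- does not move the arguments t i.  Reading f off the enumerations gives a map
-- c : Fin m → Fin n, and a greedy pass over 0, 1, …, m − 1 builds a permutation π of
-- Fin n with π (c i) ≤ i: if the value c i has not been met before, it is swapped to
-- the least unused position k, and k never exceeds the number of arguments processed.
-- Conjugating π by the enumeration b and acting with it on sort B alone gives I'.
module Submission where

open import Defs
open import Data.Nat using (ℕ; zero; suc; _<_; _≤_; s≤s)
open import Data.Nat.Properties
  using (<-≤-trans; ≤-<-trans; ≮⇒≥; <⇒≢; m≤n⇒m≤1+n; m<n⇒m<1+n; ≤-refl; ≤-reflexive; _<?_; module ≤-Reasoning)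
open import Data.Fin using (Fin; toℕ; fromℕ; fromℕ<; inject₁; _≟_)
open import Data.Fin.Properties using (toℕ<n; toℕ-fromℕ; toℕ-fromℕ<; toℕ-inject₁)
open import Data.Fin.Relation.Unary.Top using (view; ‵fromℕ; ‵inject₁)
open import Data.Fin.Permutation using (Permutation; Permutation′; _⟨$⟩ʳ_; _⟨$⟩ˡ_; _∘ₚ_; flip; transpose; inverseˡ)
import Data.Fin.Permutation as Perm
import Data.Fin.Permutation.Components as PC
open import Data.Product using (∃; _×_; _,_)
open import Data.Empty using (⊥-elim)
open import Data.List.Relation.Unary.All using (All; []; _∷_)
open import Function using (_∘_)
open import Function.Bundles using (mk⤖)
open import Function.Definitions using (Bijective)
open import Function.Properties.Bijection using (⤖⇒↔)
open import Relation.Nullary using (yes; no)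
open import Relation.Binary.PropositionalEquality
  using (_≡_; _≢_; refl; trans; cong; cong₂; module ≡-Reasoning)

transpose-matchʳ : ∀ {n} (i j : Fin n) → PC.transpose i j j ≡ i
transpose-matchʳ i j with j ≟ i
... | yes j≡i = j≡i
... | no _ with j ≟ j
...   | yes _  = refl
...   | no j≢j = ⊥-elim (j≢j refl)

transpose-fixes : ∀ {n} {i j k : Fin n} → k ≢ i → k ≢ j → PC.transpose i j k ≡ k
transpose-fixes {i = i} {j} {k} k≢i k≢j with k ≟ i
... | yes k≡i = ⊥-elim (k≢i k≡i)
... | no _ with k ≟ j
...   | yes k≡j = ⊥-elim (k≢j k≡j)
...   | no _    = refl

record Compression {m n : ℕ} (c : Fin m → Fin n) : Set where
  field
    π           : Permutation′ n
    k           : ℕ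
    k≤m         : k ≤ m
    image<      : ∀ i → toℕ (π ⟨$⟩ʳ c i) < k
    image≤index : ∀ i → toℕ (π ⟨$⟩ʳ c i) ≤ toℕ i

module Extend {m n : ℕ} (c : Fin (suc m) → Fin n) (C : Compression (c ∘ inject₁)) where
  open Compression C
  open ≤-Reasoning

  last : Fin n
  last = π ⟨$⟩ʳ c (fromℕ m)

  reuse : toℕ last < k → Compression c
  reuse last<k = record
    { π = π ; k = k ; k≤m = m≤n⇒m≤1+n k≤m ; image< = below ; image≤index = atMost }
    where
    below : ∀ i → toℕ (π ⟨$⟩ʳ c i) < k
    below i with view i
    ... | ‵fromℕ     = last<k
    ... | ‵inject₁ j = image< j

    atMost : ∀ i → toℕ (π ⟨$⟩ʳ c i) ≤ toℕ i
    atMost i with view i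
    ... | ‵fromℕ = begin
      toℕ last        <⟨ <-≤-trans last<k k≤m ⟩
      m               ≡⟨ toℕ-fromℕ m ⟨
      toℕ (fromℕ m)   ∎
    ... | ‵inject₁ j = begin
      toℕ (π ⟨$⟩ʳ c (inject₁ j)) ≤⟨ image≤index j ⟩
      toℕ j                      ≡⟨ toℕ-inject₁ j ⟨
      toℕ (inject₁ j)            ∎

  -- The fresh value is swapped to position k, which no earlier value occupies.
  fresh : k ≤ toℕ last → Compression c
  fresh k≤last = record
    { π = π′ ; k = suc k ; k≤m = s≤s k≤m ; image< = below ; image≤index = atMost }
    where
    k<n : k < n
    k<n = ≤-<-trans k≤last (toℕ<n last)
    π′ : Permutation′ n
    π′ = π ∘ₚ transpose (fromℕ< k<n) last

    new : toℕ (π′ ⟨$⟩ʳ c (fromℕ m)) ≡ k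
    new = trans (cong toℕ (transpose-matchʳ (fromℕ< k<n) last)) (toℕ-fromℕ< k<n)

    old : ∀ j → π′ ⟨$⟩ʳ c (inject₁ j) ≡ π ⟨$⟩ʳ c (inject₁ j)
    old j = transpose-fixes
      (λ eq → <⇒≢ (image< j) (trans (cong toℕ eq) (toℕ-fromℕ< k<n)))
      (λ eq → <⇒≢ (<-≤-trans (image< j) k≤last) (cong toℕ eq))

    below : ∀ i → toℕ (π′ ⟨$⟩ʳ c i) < suc k
    below i with view i
    ... | ‵fromℕ     = ≤-reflexive (cong suc new)
    ... | ‵inject₁ j = begin-strict
      toℕ (π′ ⟨$⟩ʳ c (inject₁ j)) ≡⟨ cong toℕ (old j) ⟩
      toℕ (π ⟨$⟩ʳ c (inject₁ j))  <⟨ m<n⇒m<1+n (image< j) ⟩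
      suc k                       ∎

    atMost : ∀ i → toℕ (π′ ⟨$⟩ʳ c i) ≤ toℕ i
    atMost i with view i
    ... | ‵fromℕ = begin
      toℕ (π′ ⟨$⟩ʳ c (fromℕ m)) ≡⟨ new ⟩
      k                         ≤⟨ k≤m ⟩
      m                         ≡⟨ toℕ-fromℕ m ⟨
      toℕ (fromℕ m)             ∎
    ... | ‵inject₁ j = begin
      toℕ (π′ ⟨$⟩ʳ c (inject₁ j)) ≡⟨ cong toℕ (old j) ⟩
      toℕ (π ⟨$⟩ʳ c (inject₁ j))  ≤⟨ image≤index j ⟩
      toℕ j                       ≡⟨ toℕ-inject₁ j ⟨
      toℕ (inject₁ j)             ∎

  extend : Compression c
  extend with toℕ last <? k
  ... | yes last<k = reuse last<k
  ... | no last≮k  = fresh (≮⇒≥ last≮k)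

compression : ∀ {m n} (c : Fin m → Fin n) → Compression c
compression {zero}  c = record
  { π = Perm.id ; k = 0 ; k≤m = ≤-refl ; image< = λ () ; image≤index = λ () }
compression {suc m} c = Extend.extend c (compression (c ∘ inject₁))

module Relabelling {Σ' : Signature} (U : DomainAssignment Σ') where

  Sort : Set
  Sort = Fin (nSorts Σ')

  inverse : DomainPermutation U → DomainPermutation U
  inverse σ θ = flip (σ θ)

  permTuple-inverse : ∀ σ {as} (s : Tuple U as) → permTuple U (inverse σ) (permTuple U σ s) ≡ s
  permTuple-inverse σ []      = refl
  permTuple-inverse σ (a ∷ s) = cong₂ _∷_ (inverseˡ (σ _)) (permTuple-inverse σ s)

  infixr 5 _•_
  _•_ : DomainPermutation U → Interpretation U → Interpretation U
  σ • I = record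
    { fun  = λ g s → σ (funRes Σ' g) ⟨$⟩ʳ fun I g (permTuple U (inverse σ) s)
    ; pred = λ R s → pred I R (permTuple U (inverse σ) s)
    }

  •-isAction : ∀ σ I → IsAction U σ I (σ • I)
  •-isAction σ I =
      (λ g s → cong (λ s′ → σ (funRes Σ' g) ⟨$⟩ʳ fun I g s′) (permTuple-inverse σ s))
    , (λ R s → cong (pred I R) (permTuple-inverse σ s))

  fun-fixedTuple : ∀ σ I I′ → IsAction U σ I I′ → ∀ g {s : Tuple U (funArgs Σ' g)} →
                   permTuple U σ s ≡ s → fun I′ g s ≡ σ (funRes Σ' g) ⟨$⟩ʳ fun I g s
  fun-fixedTuple σ I I′ (act , _) g {s} σs≡s = begin
    fun I′ g s                     ≡⟨ cong (fun I′ g) σs≡s ⟨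
    fun I′ g (permTuple U σ s)     ≡⟨ act g s ⟩
    σ (funRes Σ' g) ⟨$⟩ʳ fun I g s ∎
    where open ≡-Reasoning

  onSort : (θ : Sort) → Permutation′ (size U θ) → DomainPermutation U
  onSort θ ρ θ′ with θ′ ≟ θ
  ... | yes refl = ρ
  ... | no _     = Perm.id

  onSort-here : ∀ θ ρ x → onSort θ ρ θ ⟨$⟩ʳ x ≡ ρ ⟨$⟩ʳ x
  onSort-here θ ρ x with θ ≟ θ
  ... | yes refl = refl
  ... | no θ≢θ   = ⊥-elim (θ≢θ refl)

  onSort-elsewhere : ∀ {θ θ′} ρ → θ′ ≢ θ → ∀ x → onSort θ ρ θ′ ⟨$⟩ʳ x ≡ x
  onSort-elsewhere {θ} {θ′} ρ θ′≢θ x with θ′ ≟ θ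
  ... | yes θ′≡θ = ⊥-elim (θ′≢θ θ′≡θ)
  ... | no _     = refl

  permTuple-onSort-avoiding : ∀ {θ} ρ {as} → All (_≢ θ) as → (s : Tuple U as) →
                              permTuple U (onSort θ ρ) s ≡ s
  permTuple-onSort-avoiding ρ []             []      = refl
  permTuple-onSort-avoiding ρ (a≢θ ∷ as≢θ) (a ∷ s) =
    cong₂ _∷_ (onSort-elsewhere ρ a≢θ a) (permTuple-onSort-avoiding ρ as≢θ s)

mainTheorem6 : (Σ' : Signature) (U : DomainAssignment Σ')
    (f : Fin (nFuns Σ')) → DRD Σ' f →
    (m : ℕ) (t : Fin m → Tuple U (funArgs Σ' f)) → Bijective _≡_ _≡_ t →
    (n : ℕ) (b : Fin n → Dom U (funRes Σ' f)) → Bijective _≡_ _≡_ b →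
    (I : Interpretation U) →
    ∃ λ (I' : Interpretation U) → Isomorphic U I I' ×
      ((i : Fin m) → toℕ i < n →
        ∃ λ (j : Fin n) → toℕ j ≤ toℕ i × Interpretation.fun I' f (t i) ≡ b j)
mainTheorem6 Σ' U f drd m t _ n b b-bijective I =
  σ • I , (σ , •-isAction σ I) , λ i _ → π ⟨$⟩ʳ c i , image≤index i , image-f i
  where
  open Relabelling U
  B = funRes Σ' f
  β : Permutation n (size U B)
  β = ⤖⇒↔ (mk⤖ b-bijective)
  c : Fin m → Fin n
  c i = β ⟨$⟩ˡ fun I f (t i)
  open Compression (compression c)
  σ : DomainPermutation U
  σ = onSort B (flip β ∘ₚ π ∘ₚ β)
  image-f : ∀ i → fun (σ • I) f (t i) ≡ b (π ⟨$⟩ʳ c i)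
  image-f i = trans
    (fun-fixedTuple σ I (σ • I) (•-isAction σ I) f (permTuple-onSort-avoiding _ drd (t i)))
    (onSort-here B _ _)
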